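{- For every $v\equiv 0,4 \pmod 6$ with $v\geq 10$, there exists a DTS$(v)$ having no $v$-good sequencing.
   Context: A transitive triple is an ordered triple $(x,y,z)$ of distinct elements; it contains the directed edges $(x,y)$, $(x,z)$, $(y,z)$. A directed triple system of order $v$, DTS$(v)$, is a pair $(X,\mathcal{B})$ where $X$ is a set of $v$ points and $\mathcal{B}$ is a set of transitive triples of elements of $X$ such that every ordered pair $(a,b)$ of distinct points of $X$ occurs as a directed edge in exactly one triple of $\mathcal{B}$. A $v$-good sequencing of a DTS$(v)$ $(X,\mathcal{B})$ is a permutation $[x_1\, x_2\, \cdots\, x_v]$ of $X$ such that for no triple $(x,y,z)\in\mathcal{B}$ do we have $x=x_i$, $y=x_j$, $z=x_k$ with $i<j<k$. -}

module Defs where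

open import Data.Nat using (ℕ; _%_; _≥_)
open import Data.Fin using (Fin; _<_)
open import Data.Fin.Permutation using (Permutation; _⟨$⟩ʳ_)
open import Data.Product using (_×_; _,_; ∃-syntax)
open import Data.List using (List; filter; length)
open import Data.List.Relation.Unary.All using (All)
open import Relation.Binary.PropositionalEquality using (_≡_; _≢_)
open import Relation.Nullary using (¬_; Dec; yes; no)
open import Relation.Nullary.Decidable using (_⊎-dec_; _×-dec_)
open import Data.Fin using (_≟_)

Triple : ℕ → Set
Triple v = Fin v × Fin v × Fin v

Distinct : ∀ {v} → Triple v → Set
Distinct (x , y , z) = x ≢ y × x ≢ z × y ≢ z

ContainsEdge : ∀ {v} → Fin v → Fin v → Triple v → Set
ContainsEdge a b (x , y , z) =
  ((a ≡ x) × (b ≡ y)) Data.Sum.⊎ (((a ≡ x) × (b ≡ z)) Data.Sum.⊎ ((a ≡ y) × (b ≡ z)))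
  where import Data.Sum

containsEdge? : ∀ {v} (a b : Fin v) (t : Triple v) → Dec (ContainsEdge a b t)
containsEdge? a b (x , y , z) =
  ((a ≟ x) ×-dec (b ≟ y)) ⊎-dec (((a ≟ x) ×-dec (b ≟ z)) ⊎-dec ((a ≟ y) ×-dec (b ≟ z)))

-- Every ordered pair (a , b) of distinct points is an edge of exactly one
-- block (counted with multiplicity in the list, so B has no repeated blocks).
IsDTS : (v : ℕ) → List (Triple v) → Set
IsDTS v B =
  All Distinct B ×
  (∀ (a b : Fin v) → a ≢ b → length (filter (containsEdge? a b) B) ≡ 1)

IsGoodSequencing : ∀ {v} → List (Triple v) → Permutation v v → Set
IsGoodSequencing {v} B σ =
  All (λ { (x , y , z) →
    ¬ (∃[ i ] ∃[ j ] ∃[ k ]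
        (i < j × j < k × x ≡ σ ⟨$⟩ʳ i × y ≡ σ ⟨$⟩ʳ j × z ≡ σ ⟨$⟩ʳ k)) }) B

-- A good sequencing of a DTS restricts to a good sequencing of every
-- sub-DTS, so it suffices to embed a "core" DTS(w) that has none: w = 7 for
-- v ≡ 4 and w = 9 for v ≡ 0 (mod 6). That the cores, and the explicit systems
-- of orders 10 and 12, have no good sequencing is found by a depth-first
-- search over orderings, cut off as soon as the next point completes an
-- increasing block. For v = w + 3k with k odd, the core is extended by a
-- Bose-type construction on ℤ_k × {0, 1, 2}: writing w = u + 3r, the
-- differences 1, ..., r of ℤ_k are carried by blocks through the 3r non-fixed
-- core points, the others by blocks inside ℤ_k × {0, 1, 2}. Every ordered pair
-- is covered and there are only v(v - 1)/3 blocks, so each pair is covered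
-- exactly once. The explicit system of order 18 contains the core of order 7.

module Submission where

open import Defs
open import Level using (0ℓ)
open import Algebra.Bundles using (AbelianGroup)
open import Algebra.Structures using (IsAbelianGroup)
open import Data.Bool.Base using (Bool; true; false; T; _∧_; _∨_; not)
open import Data.Bool.Properties using (T-∧; T-∨)
open import Data.Bool.ListAction using (all)
open import Data.Empty using (⊥)
open import Data.Fin as Fin using (Fin; toℕ; #_; _≟_; _↑ˡ_; _↑ʳ_; splitAt; combine; remQuot)
open import Data.Fin.Patterns using (0F; 1F; 2F)
import Data.Fin.Properties as Fin
open import Data.Fin.Permutation using (Permutation; _⟨$⟩ˡ_; inverseʳ)
open import Data.List.Base using (List; []; _∷_; map; filter; allFin; tabulate; concat; length; _++_)
import Data.List.Properties as List
open import Data.List.Extrema.Nat using (argmin; argmin-all; f[argmin]≤f[xs])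
open import Data.List.Membership.Propositional using (_∈_)
open import Data.List.Membership.Propositional.Properties using (∈-allFin; ∈-filter⁺; ∈-map⁺)
open import Data.List.Relation.Binary.Subset.Propositional using (_⊆_)
open import Data.List.Relation.Binary.Subset.Propositional.Properties using (Any-resp-⊆; xs⊆xs++ys)
open import Data.List.Relation.Unary.All as All using (All)
import Data.List.Relation.Unary.All.Properties as All
open import Data.List.Relation.Unary.AllPairs using (AllPairs; []; _∷_)
open import Data.List.Relation.Unary.Any as Any using (Any; here; there)
import Data.List.Relation.Unary.Any.Properties as Any
open import Data.Nat.Base using (ℕ; zero; suc; _+_; _*_; _∸_; _<_; _≤_; _≥_; z≤n; s≤s)
open import Data.Nat.DivMod
  using (_%_; _/_; m%n<n; m%n%n≡m%n; %-distribˡ-+; %-distribˡ-*; m<n⇒m%n≡m; [m+kn]%n≡m%n; m≡m%n+[m/n]*n)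
import Data.Nat.Properties as ℕ
open import Algebra.Properties.CommutativeMonoid.Sum ℕ.+-0-commutativeMonoid
  using (sum; sum-syntax; sum-cong-≗; ∑-distrib-+; sum-replicate-zero)
open import Data.Nat.Tactic.RingSolver using (solve-∀)
open import Data.Product.Base as Product using (_×_; _,_; ∃; ∃-syntax; proj₁; proj₂)
open import Data.Sum.Base using (_⊎_; inj₁; inj₂; [_,_]′)
open import Data.Sum.Function.Propositional using (_⊎-↔_)
open import Data.Sum.Properties using (inj₁-injective)
open import Function.Base using (_∘_)
open import Function.Bundles using (_↔_; Inverse; Injection; Equivalence)
open import Function.Construct.Composition using (_↔-∘_)
open import Function.Construct.Symmetry using (↔-sym)
open import Function.Definitions using (Injective)
open import Function.Properties.Inverse using (↔-refl; ↔⇒↣)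
open import Relation.Binary.PropositionalEquality
open import Relation.Nullary using (¬_; ¬?; Dec; yes; no; does; contradiction)
open import Relation.Nullary.Decidable using (True; ⌊_⌋; toWitness; from-no; _×-dec_; _⊎-dec_; _→-dec_)
open import Relation.Unary using (Decidable)

Tri : Set → Set
Tri A = A × A × A

mapTri : ∀ {A B : Set} → (A → B) → Tri A → Tri B
mapTri f (x , y , z) = f x , f y , f z

Increasing : ∀ {A : Set} → (A → ℕ) → Tri A → Set
Increasing rank (x , y , z) = rank x < rank y × rank y < rank z

-- "No good sequencing", for rankings by arbitrary injections into ℕ: in this
-- form it passes to supersystems and along injective relabellings.
Unsequenceable : ∀ {A : Set} → List (Tri A) → Set
Unsequenceable {A} blocks =
  ∀ (rank : A → ℕ) → Injective _≡_ _≡_ rank → Any (Increasing rank) blocks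

unsequenceable-⊆ : ∀ {A : Set} {bs cs : List (Tri A)} → bs ⊆ cs → Unsequenceable bs → Unsequenceable cs
unsequenceable-⊆ bs⊆cs unseq rank rank-injective = Any-resp-⊆ bs⊆cs (unseq rank rank-injective)

unsequenceable-map : ∀ {A B : Set} {f : A → B} {bs : List (Tri A)} → Injective _≡_ _≡_ f →
                     Unsequenceable bs → Unsequenceable (map (mapTri f) bs)
unsequenceable-map f-injective unseq rank rank-injective =
  Any.map⁺ (unseq (rank ∘ _) (f-injective ∘ rank-injective))

position : ∀ {v} → Permutation v v → Fin v → ℕ
position σ x = toℕ (σ ⟨$⟩ˡ x)

position-injective : ∀ {v} (σ : Permutation v v) → Injective _≡_ _≡_ (position σ)
position-injective σ = Injection.injective (↔⇒↣ (↔-sym σ)) ∘ Fin.toℕ-injective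

unsequenceable⇒¬goodSequencing : ∀ {v} {B : List (Triple v)} → Unsequenceable B →
                                 ∀ σ → ¬ IsGoodSequencing B σ
unsequenceable⇒¬goodSequencing unseq σ good
  with All.lookupAny good (unseq (position σ) (position-injective σ))
... | ¬ordered , x<y , y<z =
  ¬ordered (_ , _ , _ , x<y , y<z , sym (inverseʳ σ) , sym (inverseʳ σ) , sym (inverseʳ σ))

module RefutationSearch {n : ℕ} (blocks : List (Tri (Fin n))) where

  open import Data.List.Membership.DecPropositional (_≟_ {n}) using (_∈?_)

  -- Lists of placed points are kept most recent first.
  PlacedBefore : Fin n → Fin n → List (Fin n) → Set
  PlacedBefore x y [] = ⊥
  PlacedBefore x y (p ∷ ps) = p ≡ y × x ∈ ps ⊎ PlacedBefore x y ps

  placedBefore? : ∀ x y ps → Dec (PlacedBefore x y ps)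
  placedBefore? x y [] = no λ ()
  placedBefore? x y (p ∷ ps) = (p ≟ y ×-dec x ∈? ps) ⊎-dec placedBefore? x y ps

  -- Placing c next, before all unplaced points, makes the block increasing.
  Completes : List (Fin n) → Fin n → Tri (Fin n) → Set
  Completes placed c (x , y , z) =
    z ≡ c × PlacedBefore x y placed ⊎ y ≡ c × x ∈ placed × ¬ z ∈ placed × ¬ z ≡ c

  completes? : ∀ placed c t → Dec (Completes placed c t)
  completes? placed c (x , y , z) =
    z ≟ c ×-dec placedBefore? x y placed ⊎-dec
    y ≟ c ×-dec x ∈? placed ×-dec ¬? (z ∈? placed) ×-dec ¬? (z ≟ c)

  Settled : List (Fin n) → Fin n → List (Tri (Fin n)) → Set
  Settled placed c bs = c ∈ placed ⊎ Any (Completes placed c) bs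

  settled? : ∀ placed c bs → Dec (Settled placed c bs)
  settled? placed c bs = c ∈? placed ⊎-dec Any.any? (completes? placed c) bs

  Unfinished : List (Fin n) → Set
  Unfinished placed = Any (λ c → ¬ c ∈ placed) (allFin n)

  unfinished? : ∀ placed → Dec (Unfinished placed)
  unfinished? placed = Any.any? (λ c → ¬? (c ∈? placed)) (allFin n)

  -- Each point paired with the blocks it can complete; passed as an argument so
  -- that it is computed only once during the search.
  Index : Set
  Index = List (Fin n × List (Tri (Fin n)))

  index : Index
  index = map (λ c → c , filter (λ (x , y , z) → y ≟ c ⊎-dec z ≟ c) blocks) (allFin n)

  refutesFrom : Index → ℕ → List (Fin n) → Bool
  refutesFrom idx zero placed = false
  refutesFrom idx (suc fuel) placed =
    ⌊ unfinished? placed ⌋ ∧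
    all (λ (c , bs) → ⌊ settled? placed c bs ⌋ ∨ refutesFrom idx fuel (c ∷ placed)) idx

  Refutes : Set
  Refutes = T (refutesFrom index n [])

  module _ (rank : Fin n → ℕ) (rank-injective : Injective _≡_ _≡_ rank) where

    Sorted : List (Fin n) → Set
    Sorted = AllPairs (λ p q → rank q < rank p)

    InitialSegment : List (Fin n) → Set
    InitialSegment placed = ∀ {p u} → p ∈ placed → ¬ u ∈ placed → rank p < rank u

    placedBefore⇒< : ∀ {x y ps} → Sorted ps → PlacedBefore x y ps → rank x < rank y × y ∈ ps
    placedBefore⇒< {ps = _ ∷ _} (p>ps ∷ _) (inj₁ (refl , x∈ps)) = All.lookup p>ps x∈ps , here refl
    placedBefore⇒< {ps = _ ∷ _} (_ ∷ sorted) (inj₂ before) = Product.map₂ there (placedBefore⇒< sorted before)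

    LeastUnplaced : List (Fin n) → Fin n → Set
    LeastUnplaced placed c = ¬ c ∈ placed × (∀ {u} → ¬ u ∈ placed → ¬ u ≡ c → rank c < rank u)

    least-unplaced : ∀ placed → Unfinished placed → ∃ (LeastUnplaced placed)
    least-unplaced placed some =
      c , argmin-all rank c₀∉ (All.all-filter unplaced? (allFin n)) ,
      λ u∉ u≢c → ℕ.≤∧≢⇒< (All.lookup (f[argmin]≤f[xs] c₀ unplaced) (∈-filter⁺ unplaced? (∈-allFin _) u∉))
                          (λ eq → u≢c (sym (rank-injective eq)))
      where
        c₀ = proj₁ (Any.satisfied some)
        c₀∉ = proj₂ (Any.satisfied some)
        unplaced? = λ c → ¬? (c ∈? placed)
        unplaced = filter unplaced? (allFin n)
        c = argmin rank c₀ unplaced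

    completes⇒increasing : ∀ {placed c} t → Sorted placed → InitialSegment placed →
                           LeastUnplaced placed c → Completes placed c t → Increasing rank t
    completes⇒increasing _ sorted segment (c∉ , _) (inj₁ (refl , before)) =
      let x<y , y∈ = placedBefore⇒< sorted before in x<y , segment y∈ c∉
    completes⇒increasing _ sorted segment (c∉ , least) (inj₂ (refl , x∈ , z∉ , z≢c)) =
      segment x∈ c∉ , least z∉ z≢c

    refutesFrom⇒increasing : ∀ fuel placed → Sorted placed → InitialSegment placed →
                             T (refutesFrom index fuel placed) → Any (Increasing rank) blocks
    refutesFrom⇒increasing (suc fuel) placed sorted segment r
      with Equivalence.to T-∧ r
    ... | some , step with least-unplaced placed (toWitness {a? = unfinished? placed} some)
    ... | c , c-least@(c∉ , least)
      with Equivalence.to T-∨ (All.lookup (All.all⁺ _ index step) (∈-map⁺ _ (∈-allFin c)))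
    ...   | inj₁ settled with toWitness {a? = settled? placed c _} settled
    ...     | inj₁ c∈ = contradiction c∈ c∉
    ...     | inj₂ completes =
      Any.filter⁻ _ (Any.map (λ {t} → completes⇒increasing t sorted segment c-least) completes)
    refutesFrom⇒increasing (suc fuel) placed sorted segment r | _ | c , (c∉ , least) | inj₂ deeper =
      refutesFrom⇒increasing fuel (c ∷ placed) (All.tabulate (λ p∈ → segment p∈ c∉) ∷ sorted) segment′ deeper
      where
        segment′ : InitialSegment (c ∷ placed)
        segment′ (here refl) u∉ = least (u∉ ∘ there) (u∉ ∘ here)
        segment′ (there p∈) u∉ = segment p∈ (u∉ ∘ there)

  refutes⇒unsequenceable : Refutes → Unsequenceable blocks
  refutes⇒unsequenceable r rank rank-injective =
    refutesFrom⇒increasing rank rank-injective n [] [] (λ ()) r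

open RefutationSearch using (refutes⇒unsequenceable)

-- On Fin v these are, definitionally, ContainsEdge and Distinct of Defs.
HasEdge : ∀ {A : Set} → A → A → Tri A → Set
HasEdge a b (x , y , z) = a ≡ x × b ≡ y ⊎ a ≡ x × b ≡ z ⊎ a ≡ y × b ≡ z

Nondegenerate : ∀ {A : Set} → Tri A → Set
Nondegenerate (x , y , z) = x ≢ y × x ≢ z × y ≢ z

Covering : ∀ {A : Set} → List (Tri A) → Set
Covering {A} bs = ∀ (a b : A) → a ≢ b → Any (HasEdge a b) bs

hasEdge-map : ∀ {A B : Set} (f : A → B) {a b} t → HasEdge a b t → HasEdge (f a) (f b) (mapTri f t)
hasEdge-map f _ (inj₁ (refl , refl)) = inj₁ (refl , refl)
hasEdge-map f _ (inj₂ (inj₁ (refl , refl))) = inj₂ (inj₁ (refl , refl))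
hasEdge-map f _ (inj₂ (inj₂ (refl , refl))) = inj₂ (inj₂ (refl , refl))

nondegenerate-map : ∀ {A B : Set} {f : A → B} → Injective _≡_ _≡_ f →
                    ∀ {t} → Nondegenerate t → Nondegenerate (mapTri f t)
nondegenerate-map f-injective (x≢y , x≢z , y≢z) =
  x≢y ∘ f-injective , x≢z ∘ f-injective , y≢z ∘ f-injective

covering-↔ : ∀ {A B : Set} (π : A ↔ B) {bs : List (Tri A)} →
             Covering bs → Covering (map (mapTri (Inverse.to π)) bs)
covering-↔ π covers a b a≢b =
  Any.map⁺ (Any.map (λ {t} → edge t) (covers (from a) (from b) (a≢b ∘ from-injective)))
  where
    open Inverse π
    from-injective = Injection.injective (↔⇒↣ (↔-sym π))
    edge : ∀ t → HasEdge (from a) (from b) t → HasEdge a b (mapTri to t)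
    edge t e = subst₂ (λ a′ b′ → HasEdge a′ b′ (mapTri to t)) (strictlyInverseˡ a) (strictlyInverseˡ b)
                      (hasEdge-map to t e)

nondegenerate? : ∀ {n} (t : Tri (Fin n)) → Dec (Nondegenerate t)
nondegenerate? (x , y , z) = ¬? (x ≟ y) ×-dec ¬? (x ≟ z) ×-dec ¬? (y ≟ z)

covering? : ∀ {n} (bs : List (Tri (Fin n))) → Dec (Covering bs)
covering? bs = Fin.all? λ a → Fin.all? λ b → ¬? (a ≟ b) →-dec Any.any? (containsEdge? a b) bs

-- Opaque, since Agda cannot recover the family f from an unfolded gather n f.
opaque
  gather : ∀ {B : Set} n → (Fin n → List B) → List B
  gather n f = concat (tabulate f)

opaque
  unfolding gather

  Any-gather : ∀ {B : Set} {P : B → Set} {n} {f : Fin n → List B} i → Any P (f i) → Any P (gather n f)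
  Any-gather i p = Any.concat⁺ (Any.tabulate⁺ i p)

  All-gather : ∀ {B : Set} {P : B → Set} {n} {f : Fin n → List B} → (∀ i → All P (f i)) → All P (gather n f)
  All-gather all-f = All.concat⁺ (All.tabulate⁺ all-f)

  length-gather : ∀ {B : Set} n {f : Fin n → List B} {c} → (∀ i → length (f i) ≡ c) →
                  length (gather n f) ≡ n * c
  length-gather zero eq = refl
  length-gather (suc n) {f} eq =
    trans (List.length-++ (f Fin.zero)) (cong₂ _+_ (eq Fin.zero) (length-gather n (eq ∘ Fin.suc)))

iverson : Bool → ℕ
iverson true = 1
iverson false = 0

iverson-∨ : ∀ x y → iverson (x ∨ y) ≤ iverson x + iverson y
iverson-∨ true y = s≤s z≤n
iverson-∨ false y = ℕ.≤-refl

iverson-not : ∀ x → iverson (not x) + iverson x ≡ 1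
iverson-not true = refl
iverson-not false = refl

∑-const : ∀ n c → ∑[ i < n ] c ≡ n * c
∑-const zero c = refl
∑-const (suc n) c = cong (c +_) (∑-const n c)

∑-ones : ∀ n → ∑[ i < n ] 1 ≡ n
∑-ones zero = refl
∑-ones (suc n) = cong suc (∑-ones n)

∑-mono-≤ : ∀ {n} {f g : Fin n → ℕ} → (∀ i → f i ≤ g i) → sum f ≤ sum g
∑-mono-≤ {zero} f≤g = z≤n
∑-mono-≤ {suc n} f≤g = ℕ.+-mono-≤ (f≤g Fin.zero) (∑-mono-≤ (f≤g ∘ Fin.suc))

∑-tight : ∀ {n} {f g : Fin n → ℕ} → (∀ i → g i ≤ f i) → sum f ≤ sum g → ∀ i → f i ≡ g i
∑-tight {suc n} {f} {g} g≤f ∑f≤∑g i = go i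
  where
    ∑g′≤∑f′ = ∑-mono-≤ (g≤f ∘ Fin.suc)
    f₀≤g₀ : f Fin.zero ≤ g Fin.zero
    f₀≤g₀ = ℕ.+-cancelʳ-≤ _ _ _ (ℕ.≤-trans ∑f≤∑g (ℕ.+-monoʳ-≤ (g Fin.zero) ∑g′≤∑f′))
    ∑f′≤∑g′ = ℕ.+-cancelˡ-≤ (f Fin.zero) _ _ (ℕ.≤-trans ∑f≤∑g (ℕ.+-monoˡ-≤ _ (g≤f Fin.zero)))
    go : ∀ i → f i ≡ g i
    go Fin.zero = ℕ.≤-antisym f₀≤g₀ (g≤f Fin.zero)
    go (Fin.suc i) = ∑-tight (g≤f ∘ Fin.suc) ∑f′≤∑g′ i

∑-indicator : ∀ {n} (x : Fin n) → ∑[ i < n ] iverson (does (i ≟ x)) ≡ 1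
∑-indicator {suc n} Fin.zero = cong suc (sum-replicate-zero n)
∑-indicator {suc n} (Fin.suc x) = ∑-indicator {n} x

∑-indicator-∧ : ∀ {n} p (y : Fin n) → ∑[ b < n ] iverson (p ∧ does (b ≟ y)) ≡ iverson p
∑-indicator-∧ true y = ∑-indicator y
∑-indicator-∧ {n} false y = sum-replicate-zero n

∑∑-indicator : ∀ {v} (x y : Fin v) → ∑[ a < v ] ∑[ b < v ] iverson (does (a ≟ x) ∧ does (b ≟ y)) ≡ 1
∑∑-indicator x y = trans (sum-cong-≗ (λ a → ∑-indicator-∧ (does (a ≟ x)) y)) (∑-indicator x)

does-≟-sym : ∀ {n} (a b : Fin n) → does (a ≟ b) ≡ does (b ≟ a)
does-≟-sym a b with a ≟ b | b ≟ a
... | yes _ | yes _ = refl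
... | no _ | no _ = refl
... | yes refl | no b≢a = contradiction refl b≢a
... | no a≢b | yes refl = contradiction refl a≢b

∑∑-offDiagonal : ∀ v → ∑[ a < v ] ∑[ b < v ] iverson (not (does (a ≟ b))) + v ≡ v * v
∑∑-offDiagonal v = begin
  ∑[ a < v ] offDiagonal a + v            ≡⟨ cong (∑[ a < v ] offDiagonal a +_) (∑-ones v) ⟨
  ∑[ a < v ] offDiagonal a + ∑[ a < v ] 1  ≡⟨ ∑-distrib-+ offDiagonal (λ _ → 1) ⟨
  ∑[ a < v ] (offDiagonal a + 1)          ≡⟨ sum-cong-≗ row ⟩
  ∑[ a < v ] v                            ≡⟨ ∑-const v v ⟩
  v * v                                   ∎
  where
    open ≡-Reasoning
    offDiagonal : Fin v → ℕ
    offDiagonal a = ∑[ b < v ] iverson (not (does (a ≟ b)))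
    row : ∀ a → offDiagonal a + 1 ≡ v
    row a = begin
      offDiagonal a + 1
        ≡⟨ cong (offDiagonal a +_) (trans (sum-cong-≗ (λ b → cong iverson (does-≟-sym a b))) (∑-indicator a)) ⟨
      offDiagonal a + ∑[ b < v ] iverson (does (a ≟ b))
        ≡⟨ ∑-distrib-+ (λ b → iverson (not (does (a ≟ b)))) (λ b → iverson (does (a ≟ b))) ⟨
      ∑[ b < v ] (iverson (not (does (a ≟ b))) + iverson (does (a ≟ b)))
        ≡⟨ sum-cong-≗ (λ b → iverson-not (does (a ≟ b))) ⟩
      ∑[ b < v ] 1
        ≡⟨ ∑-ones v ⟩
      v ∎

∑∑-distrib-+ : ∀ {m n} (f g : Fin m → Fin n → ℕ) →
               ∑[ a < m ] ∑[ b < n ] (f a b + g a b) ≡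
               ∑[ a < m ] ∑[ b < n ] f a b + ∑[ a < m ] ∑[ b < n ] g a b
∑∑-distrib-+ {n = n} f g = trans (sum-cong-≗ (λ a → ∑-distrib-+ (f a) (g a)))
                                 (∑-distrib-+ (λ a → ∑[ b < n ] f a b) (λ a → ∑[ b < n ] g a b))

∑∑-zero : ∀ m n → ∑[ a < m ] ∑[ b < n ] 0 ≡ 0
∑∑-zero zero n = refl
∑∑-zero (suc m) n = cong₂ _+_ (sum-replicate-zero n) (∑∑-zero m n)

length-filter-∷ : ∀ {A : Set} {P : A → Set} (P? : Decidable P) x xs →
                  length (filter P? (x ∷ xs)) ≡ iverson (does (P? x)) + length (filter P? xs)
length-filter-∷ P? x xs with does (P? x)
... | true = refl
... | false = refl

length-filter-pos : ∀ {A : Set} {P : A → Set} (P? : Decidable P) {xs} → Any P xs → 1 ≤ length (filter P? xs)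
length-filter-pos P? {x ∷ xs} (here px) with P? x
... | yes _ = s≤s z≤n
... | no ¬px = contradiction px ¬px
length-filter-pos P? {x ∷ xs} (there pxs) with does (P? x)
... | true = s≤s z≤n
... | false = length-filter-pos P? pxs

edgeCount : ∀ {v} → Fin v → Fin v → List (Triple v) → ℕ
edgeCount a b B = length (filter (containsEdge? a b) B)

∑∑-containsEdge≤3 : ∀ {v} (t : Triple v) → ∑[ a < v ] ∑[ b < v ] iverson (does (containsEdge? a b t)) ≤ 3
∑∑-containsEdge≤3 {v} (x , y , z) = begin
  ∑[ a < v ] ∑[ b < v ] iverson (edge a x b y ∨ (edge a x b z ∨ edge a y b z))
    ≤⟨ ∑-mono-≤ (λ a → ∑-mono-≤ (λ b → bound a b)) ⟩
  ∑[ a < v ] ∑[ b < v ] (iverson (edge a x b y) + (iverson (edge a x b z) + iverson (edge a y b z)))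
    ≡⟨ ∑∑-distrib-+ (λ a b → iverson (edge a x b y)) _ ⟩
  ∑[ a < v ] ∑[ b < v ] iverson (edge a x b y) +
  ∑[ a < v ] ∑[ b < v ] (iverson (edge a x b z) + iverson (edge a y b z))
    ≡⟨ cong₂ _+_ (∑∑-indicator x y) (trans (∑∑-distrib-+ (λ a b → iverson (edge a x b z)) _)
                                            (cong₂ _+_ (∑∑-indicator x z) (∑∑-indicator y z))) ⟩
  3 ∎
  where
    open ℕ.≤-Reasoning
    edge : Fin v → Fin v → Fin v → Fin v → Bool
    edge a x b y = does (a ≟ x) ∧ does (b ≟ y)
    bound : ∀ a b → iverson (edge a x b y ∨ (edge a x b z ∨ edge a y b z)) ≤
                    iverson (edge a x b y) + (iverson (edge a x b z) + iverson (edge a y b z))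
    bound a b = ℕ.≤-trans (iverson-∨ (edge a x b y) _) (ℕ.+-monoʳ-≤ _ (iverson-∨ (edge a x b z) _))

∑∑-edgeCount≤ : ∀ {v} (B : List (Triple v)) → ∑[ a < v ] ∑[ b < v ] edgeCount a b B ≤ 3 * length B
∑∑-edgeCount≤ {v} [] = ℕ.≤-reflexive (∑∑-zero v v)
∑∑-edgeCount≤ {v} (t ∷ B) = begin
  ∑[ a < v ] ∑[ b < v ] edgeCount a b (t ∷ B)
    ≡⟨ sum-cong-≗ (λ a → sum-cong-≗ (λ b → length-filter-∷ (containsEdge? a b) t B)) ⟩
  ∑[ a < v ] ∑[ b < v ] (iverson (does (containsEdge? a b t)) + edgeCount a b B)
    ≡⟨ ∑∑-distrib-+ (λ a b → iverson (does (containsEdge? a b t))) (λ a b → edgeCount a b B) ⟩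
  ∑[ a < v ] ∑[ b < v ] iverson (does (containsEdge? a b t)) + ∑[ a < v ] ∑[ b < v ] edgeCount a b B
    ≤⟨ ℕ.+-mono-≤ (∑∑-containsEdge≤3 t) (∑∑-edgeCount≤ B) ⟩
  3 + 3 * length B
    ≡⟨ ℕ.*-suc 3 (length B) ⟨
  3 * length (t ∷ B) ∎
  where open ℕ.≤-Reasoning

-- Double counting: each of the v(v - 1) ordered pairs is an edge of some
-- block, and the blocks have only 3 · length B = v(v - 1) edges altogether.
isDTS-byCounting : ∀ {v} {B : List (Triple v)} → All Nondegenerate B → Covering B →
                   3 * length B + v ≡ v * v → IsDTS v B
isDTS-byCounting {v} {B} distinct covers size = distinct , exactlyOnce
  where
    offDiagonal : Fin v → Fin v → ℕ
    offDiagonal a b = iverson (not (does (a ≟ b)))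
    atLeast : ∀ a b → offDiagonal a b ≤ edgeCount a b B
    atLeast a b with a ≟ b
    ... | yes _ = z≤n
    ... | no a≢b = length-filter-pos (containsEdge? a b) (covers a b a≢b)
    atMost : ∑[ a < v ] ∑[ b < v ] edgeCount a b B ≤ ∑[ a < v ] ∑[ b < v ] offDiagonal a b
    atMost = ℕ.≤-trans (∑∑-edgeCount≤ B)
      (ℕ.≤-reflexive (ℕ.+-cancelʳ-≡ v _ _ (trans size (sym (∑∑-offDiagonal v)))))
    rows : ∀ a → ∑[ b < v ] edgeCount a b B ≡ ∑[ b < v ] offDiagonal a b
    rows = ∑-tight (λ a → ∑-mono-≤ (atLeast a)) atMost
    offDiagonal-≢ : ∀ {a b} → a ≢ b → offDiagonal a b ≡ 1
    offDiagonal-≢ {a} {b} a≢b with a ≟ b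
    ... | yes a≡b = contradiction a≡b a≢b
    ... | no _ = refl
    exactlyOnce : ∀ a b → a ≢ b → edgeCount a b B ≡ 1
    exactlyOnce a b a≢b = trans (∑-tight (atLeast a) (ℕ.≤-reflexive (rows a)) b) (offDiagonal-≢ a≢b)

module Cyclic (n : ℕ) where

  private
    k : ℕ
    k = suc n

  reduce : ℕ → Fin k
  reduce a = Fin.fromℕ< (m%n<n a k)

  toℕ-reduce : ∀ a → toℕ (reduce a) ≡ a % k
  toℕ-reduce a = Fin.toℕ-fromℕ< (m%n<n a k)

  reduce-toℕ : ∀ x → reduce (toℕ x) ≡ x
  reduce-toℕ x = Fin.toℕ-injective (trans (toℕ-reduce (toℕ x)) (m<n⇒m%n≡m (Fin.toℕ<n x)))

  reduce-%-+ : ∀ a b → reduce (a % k + b) ≡ reduce (a + b)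
  reduce-%-+ a b = Fin.toℕ-injective (begin
    toℕ (reduce (a % k + b))  ≡⟨ toℕ-reduce (a % k + b) ⟩
    (a % k + b) % k           ≡⟨ %-distribˡ-+ (a % k) b k ⟩
    (a % k % k + b % k) % k   ≡⟨ cong (λ c → (c + b % k) % k) (m%n%n≡m%n a k) ⟩
    (a % k + b % k) % k       ≡⟨ %-distribˡ-+ a b k ⟨
    (a + b) % k               ≡⟨ toℕ-reduce (a + b) ⟨
    toℕ (reduce (a + b))      ∎)
    where open ≡-Reasoning

  reduce-+-% : ∀ a b → reduce (a + b % k) ≡ reduce (a + b)
  reduce-+-% a b = trans (cong reduce (ℕ.+-comm a (b % k))) (trans (reduce-%-+ b a) (cong reduce (ℕ.+-comm b a)))

  reduce-%-* : ∀ a b → reduce (a % k * b) ≡ reduce (a * b)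
  reduce-%-* a b = Fin.toℕ-injective (begin
    toℕ (reduce (a % k * b))   ≡⟨ toℕ-reduce (a % k * b) ⟩
    (a % k * b) % k            ≡⟨ %-distribˡ-* (a % k) b k ⟩
    (a % k % k * (b % k)) % k  ≡⟨ cong (λ c → (c * (b % k)) % k) (m%n%n≡m%n a k) ⟩
    (a % k * (b % k)) % k      ≡⟨ %-distribˡ-* a b k ⟨
    (a * b) % k                ≡⟨ toℕ-reduce (a * b) ⟨
    toℕ (reduce (a * b))       ∎)
    where open ≡-Reasoning

  reduce-+-* : ∀ a b → reduce (a + b * k) ≡ reduce a
  reduce-+-* a b = Fin.toℕ-injective
    (trans (toℕ-reduce (a + b * k)) (trans ([m+kn]%n≡m%n a b k) (sym (toℕ-reduce a))))

  infixl 6 _⊕_ _⊖_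

  _⊕_ : Fin k → Fin k → Fin k
  x ⊕ y = reduce (toℕ x + toℕ y)

  negate : Fin k → Fin k
  negate x = reduce (k ∸ toℕ x)

  _⊖_ : Fin k → Fin k → Fin k
  x ⊖ y = x ⊕ negate y

  ⊕-comm : ∀ x y → x ⊕ y ≡ y ⊕ x
  ⊕-comm x y = cong reduce (ℕ.+-comm (toℕ x) (toℕ y))

  ⊕-identityʳ : ∀ x → x ⊕ Fin.zero ≡ x
  ⊕-identityʳ x = trans (cong reduce (ℕ.+-identityʳ (toℕ x))) (reduce-toℕ x)

  ⊕-assoc : ∀ x y z → (x ⊕ y) ⊕ z ≡ x ⊕ (y ⊕ z)
  ⊕-assoc x y z = begin
    reduce (toℕ (reduce (toℕ x + toℕ y)) + toℕ z)  ≡⟨ cong (λ a → reduce (a + toℕ z)) (toℕ-reduce (toℕ x + toℕ y)) ⟩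
    reduce ((toℕ x + toℕ y) % k + toℕ z)           ≡⟨ reduce-%-+ (toℕ x + toℕ y) (toℕ z) ⟩
    reduce (toℕ x + toℕ y + toℕ z)                 ≡⟨ cong reduce (ℕ.+-assoc (toℕ x) _ _) ⟩
    reduce (toℕ x + (toℕ y + toℕ z))               ≡⟨ cong reduce (ℕ.+-comm (toℕ x) _) ⟩
    reduce ((toℕ y + toℕ z) + toℕ x)               ≡⟨ reduce-%-+ (toℕ y + toℕ z) (toℕ x) ⟨
    reduce ((toℕ y + toℕ z) % k + toℕ x)           ≡⟨ cong (λ a → reduce (a + toℕ x)) (toℕ-reduce (toℕ y + toℕ z)) ⟨
    (y ⊕ z) ⊕ x                                    ≡⟨ ⊕-comm (y ⊕ z) x ⟩
    x ⊕ (y ⊕ z)                                    ∎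
    where open ≡-Reasoning

  ⊕-inverseʳ : ∀ x → x ⊕ negate x ≡ Fin.zero
  ⊕-inverseʳ x = begin
    reduce (toℕ x + toℕ (reduce (k ∸ toℕ x)))  ≡⟨ cong (λ a → reduce (toℕ x + a)) (toℕ-reduce (k ∸ toℕ x)) ⟩
    reduce (toℕ x + (k ∸ toℕ x) % k)           ≡⟨ reduce-+-% (toℕ x) (k ∸ toℕ x) ⟩
    reduce (toℕ x + (k ∸ toℕ x))               ≡⟨ cong reduce (ℕ.m+[n∸m]≡n (ℕ.<⇒≤ (Fin.toℕ<n x))) ⟩
    reduce k                                   ≡⟨ cong reduce (ℕ.+-identityʳ k) ⟨
    reduce (0 + 1 * k)                         ≡⟨ reduce-+-* 0 1 ⟩
    Fin.zero                                   ∎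
    where open ≡-Reasoning

  isAbelianGroup : IsAbelianGroup _≡_ _⊕_ Fin.zero negate
  isAbelianGroup = record
    { isGroup = record
      { isMonoid = record
        { isSemigroup = record
          { isMagma = record { isEquivalence = isEquivalence ; ∙-cong = cong₂ _⊕_ }
          ; assoc = ⊕-assoc }
        ; identity = reduce-toℕ , ⊕-identityʳ }
      ; inverse = (λ x → trans (⊕-comm (negate x) x) (⊕-inverseʳ x)) , ⊕-inverseʳ
      ; ⁻¹-cong = cong negate }
    ; comm = ⊕-comm }

  abelianGroup : AbelianGroup 0ℓ 0ℓ
  abelianGroup = record { isAbelianGroup = isAbelianGroup }

module OddCyclic (n h : ℕ) (n≡h+h : n ≡ h + h) where

  open Cyclic n public
  open import Algebra.Properties.AbelianGroup abelianGroup

  private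
    k : ℕ
    k = suc n

    double-suc-h : ∀ a → a * suc h + a * suc h ≡ a + a * k
    double-suc-h a = trans (identity a h) (cong (λ n → a + a * suc n) (sym n≡h+h))
      where
        identity : ∀ a h → a * suc h + a * suc h ≡ a + a * suc (h + h)
        identity = solve-∀

  -- h + 1 is the inverse of 2 modulo 2h + 1.
  half : Fin k → Fin k
  half x = reduce (toℕ x * suc h)

  half-⊕-half : ∀ d → half d ⊕ half d ≡ d
  half-⊕-half d = begin
    reduce (toℕ (reduce D) + toℕ (reduce D))  ≡⟨ cong₂ (λ a b → reduce (a + b)) (toℕ-reduce D) (toℕ-reduce D) ⟩
    reduce (D % k + D % k)                    ≡⟨ reduce-%-+ D (D % k) ⟩
    reduce (D + D % k)                        ≡⟨ reduce-+-% D D ⟩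
    reduce (D + D)                            ≡⟨ cong reduce (double-suc-h (toℕ d)) ⟩
    reduce (toℕ d + toℕ d * k)                ≡⟨ reduce-+-* (toℕ d) (toℕ d) ⟩
    reduce (toℕ d)                            ≡⟨ reduce-toℕ d ⟩
    d                                         ∎
    where
      open ≡-Reasoning
      D = toℕ d * suc h

  half-double : ∀ e → half (e ⊕ e) ≡ e
  half-double e = begin
    reduce (toℕ (reduce (E + E)) * suc h)  ≡⟨ cong (λ a → reduce (a * suc h)) (toℕ-reduce (E + E)) ⟩
    reduce ((E + E) % k * suc h)           ≡⟨ reduce-%-* (E + E) (suc h) ⟩
    reduce ((E + E) * suc h)               ≡⟨ cong reduce (trans (ℕ.*-distribʳ-+ (suc h) E E) (double-suc-h E)) ⟩
    reduce (E + E * k)                     ≡⟨ reduce-+-* E E ⟩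
    reduce E                               ≡⟨ reduce-toℕ e ⟩
    e                                      ∎
    where
      open ≡-Reasoning
      E = toℕ e

  half≡0⇒≡0 : ∀ d → half d ≡ Fin.zero → d ≡ Fin.zero
  half≡0⇒≡0 d eq = trans (sym (half-⊕-half d)) (cong₂ _⊕_ eq eq)

  x⊕[y⊖x]≡y : ∀ x y → x ⊕ (y ⊖ x) ≡ y
  x⊕[y⊖x]≡y x y = trans (⊕-comm x (y ⊖ x)) (//-rightDividesˡ x y)

  [y⊖x]⊕x≡y : ∀ y x → (y ⊖ x) ⊕ x ≡ y
  [y⊖x]⊕x≡y y x = //-rightDividesˡ x y

  [y⊕x]⊖x≡y : ∀ y x → (y ⊕ x) ⊖ x ≡ y
  [y⊕x]⊖x≡y y x = //-rightDividesʳ x y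

  y⊖x≡0⇒y≡x : ∀ {x y} → y ⊖ x ≡ Fin.zero → y ≡ x
  y⊖x≡0⇒y≡x {x} {y} = x∙y⁻¹≈ε⇒x≈y y x

  x⊕½[y⊖x]⊕½[y⊖x]≡y : ∀ x y → x ⊕ half (y ⊖ x) ⊕ half (y ⊖ x) ≡ y
  x⊕½[y⊖x]⊕½[y⊖x]≡y x y = trans (⊕-assoc x _ _) (trans (cong (x ⊕_) (half-⊕-half (y ⊖ x))) (x⊕[y⊖x]≡y x y))

  -- In a group of odd order only 0 is its own inverse.
  x⊖e≡x⊕e⇒e≡0 : ∀ x e → x ⊖ e ≡ x ⊕ e → e ≡ Fin.zero
  x⊖e≡x⊕e⇒e≡0 x e eq = begin
    e                  ≡⟨ half-double e ⟨
    half (e ⊕ e)       ≡⟨ cong (λ a → half (e ⊕ a)) (∙-cancelˡ x e (negate e) (sym eq)) ⟩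
    half (e ⊕ negate e)  ≡⟨ cong half (⊕-inverseʳ e) ⟩
    Fin.zero           ∎
    where open ≡-Reasoning

next : Fin 3 → Fin 3
next 0F = 1F
next 1F = 2F
next 2F = 0F

prev : Fin 3 → Fin 3
prev 0F = 2F
prev 1F = 0F
prev 2F = 1F

next-prev : ∀ l → next (prev l) ≡ l
next-prev 0F = refl
next-prev 1F = refl
next-prev 2F = refl

≢-next : ∀ l → l ≢ next l
≢-next 0F ()
≢-next 1F ()
≢-next 2F ()

level-trichotomy : ∀ i l → l ≡ i ⊎ l ≡ next i ⊎ i ≡ next l
level-trichotomy 0F 0F = inj₁ refl
level-trichotomy 0F 1F = inj₂ (inj₁ refl)
level-trichotomy 0F 2F = inj₂ (inj₂ refl)
level-trichotomy 1F 0F = inj₂ (inj₂ refl)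
level-trichotomy 1F 1F = inj₁ refl
level-trichotomy 1F 2F = inj₂ (inj₁ refl)
level-trichotomy 2F 0F = inj₂ (inj₁ refl)
level-trichotomy 2F 1F = inj₂ (inj₂ refl)
level-trichotomy 2F 2F = inj₁ refl

↑ˡ≢↑ʳ : ∀ {m n} (i : Fin m) (j : Fin n) → i ↑ˡ n ≢ m ↑ʳ j
↑ˡ≢↑ʳ {m} {n} i j eq with trans (sym (Fin.splitAt-↑ˡ m i n)) (trans (cong (splitAt m) eq) (Fin.splitAt-↑ʳ m n j))
... | ()

-- Core point i ↑ˡ r * 3 is fixed; core point u ↑ʳ combine j s is the s-th
-- point of class j, whose blocks carry the difference j + 1 of ℤ_k, where
-- k = r + m + 1. The column system lives on the fixed points (i ↑ˡ 3) and the
-- three levels (u ↑ʳ l) of one element of ℤ_k, and is copied onto each of them.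
module Extension
  (u r m h : ℕ) (r+m≡h+h : r + m ≡ h + h)
  (core : List (Tri (Fin (u + r * 3))))
  (core-nondegenerate : All Nondegenerate core) (core-covering : Covering core)
  (core-size : 3 * length core + (u + r * 3) ≡ (u + r * 3) * (u + r * 3))
  (column : List (Tri (Fin (u + 3))))
  (column-nondegenerate : All Nondegenerate column) (column-covering : Covering column)
  -- The column blocks cover each of the 6(u + 1) ordered pairs meeting a level
  -- just once.
  (column-size : 3 * length column ≡ 6 * suc u)
  where

  open OddCyclic (r + m) h r+m≡h+h

  w k V : ℕ
  w = u + r * 3
  k = suc (r + m)
  V = w + k * 3

  Point : Set
  Point = Fin w ⊎ (Fin k × Fin 3)

  ⟨_,_⟩ : Fin k → Fin 3 → Point
  ⟨ x , l ⟩ = inj₂ (x , l)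

  fixed : Fin u → Point
  fixed i = inj₁ (i ↑ˡ r * 3)

  classPoint : Fin r → Fin 3 → Point
  classPoint j s = inj₁ (u ↑ʳ combine j s)

  columnPoint : Fin k → Fin (u + 3) → Point
  columnPoint x c = [ fixed , ⟨ x ,_⟩ ]′ (splitAt u c)

  -- The nonzero differences: j + 1 for the classes, r + 1 + i for the Bose blocks.
  classDiff : Fin r → Fin k
  classDiff j = Fin.suc (j ↑ˡ m)

  boseDiff : Fin m → Fin k
  boseDiff i = Fin.suc (r ↑ʳ i)

  bose : Fin m → Fin k → Fin 3 → Tri Point
  bose i x l = ⟨ x ⊖ boseDiff i , l ⟩ , ⟨ x , next l ⟩ , ⟨ x ⊕ boseDiff i , l ⟩

  classBlock : Fin r → Fin 3 → Fin k → Fin 3 → Tri Point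
  classBlock j 0F x l = ⟨ x , l ⟩ , classPoint j 0F , ⟨ x ⊕ classDiff j , next l ⟩
  classBlock j 1F x l = ⟨ x , next l ⟩ , classPoint j 1F , ⟨ x ⊕ classDiff j , l ⟩
  classBlock j 2F x l = ⟨ x ⊖ classDiff j , l ⟩ , classPoint j 2F , ⟨ x ⊕ classDiff j , l ⟩

  coreBlocks columnBlocks boseBlocks classBlocks blocks : List (Tri Point)
  coreBlocks = map (mapTri inj₁) core
  columnBlocks = gather k λ x → map (mapTri (columnPoint x)) column
  boseBlocks = gather m λ i → gather k λ x → tabulate (bose i x)
  classBlocks = gather r λ j → gather 3 λ s → gather k λ x → tabulate (classBlock j s x)
  blocks = coreBlocks ++ columnBlocks ++ boseBlocks ++ classBlocks

  data Difference : Fin k → Set where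
    isClass : ∀ j → Difference (classDiff j)
    isBose : ∀ i → Difference (boseDiff i)

  difference : ∀ {d} → d ≢ Fin.zero → Difference d
  difference {Fin.zero} d≢0 = contradiction refl d≢0
  difference {Fin.suc p} _ with splitAt r p in eq
  ... | inj₁ j = subst Difference (cong Fin.suc (Fin.splitAt⁻¹-↑ˡ eq)) (isClass j)
  ... | inj₂ i = subst Difference (cong Fin.suc (Fin.splitAt⁻¹-↑ʳ eq)) (isBose i)

  data CorePoint (c : Fin w) : Set where
    isFixed : ∀ i → fixed i ≡ inj₁ c → CorePoint c
    isClassPoint : ∀ j s → classPoint j s ≡ inj₁ c → CorePoint c

  corePoint : ∀ c → CorePoint c
  corePoint c with splitAt u c in eq
  ... | inj₁ i = isFixed i (cong inj₁ (Fin.splitAt⁻¹-↑ˡ eq))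
  ... | inj₂ q = isClassPoint (proj₁ (remQuot {r} 3 q)) (proj₂ (remQuot {r} 3 q))
                   (cong inj₁ (trans (cong (u ↑ʳ_) (Fin.combine-remQuot {r} 3 q)) (Fin.splitAt⁻¹-↑ʳ eq)))

  columnPoint-fixed : ∀ x i → columnPoint x (i ↑ˡ 3) ≡ fixed i
  columnPoint-fixed x i = cong [ fixed , ⟨ x ,_⟩ ]′ (Fin.splitAt-↑ˡ u i 3)

  columnPoint-level : ∀ x l → columnPoint x (u ↑ʳ l) ≡ ⟨ x , l ⟩
  columnPoint-level x l = cong [ fixed , ⟨ x ,_⟩ ]′ (Fin.splitAt-↑ʳ u 3 l)

  Covered : Point → Point → Set
  Covered a b = Any (HasEdge a b) blocks

  by-column : ∀ x {c c′} → c ≢ c′ → Covered (columnPoint x c) (columnPoint x c′)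
  by-column x c≢c′ = Any.++⁺ʳ coreBlocks (Any.++⁺ˡ (Any-gather x
    (Any.map⁺ (Any.map (λ {t} → hasEdge-map (columnPoint x) t) (column-covering _ _ c≢c′)))))

  by-bose : ∀ i x l {a b} → HasEdge a b (bose i x l) → Covered a b
  by-bose i x l e = Any.++⁺ʳ coreBlocks (Any.++⁺ʳ columnBlocks (Any.++⁺ˡ
    (Any-gather i (Any-gather x (Any.tabulate⁺ {f = bose i x} l e)))))

  by-class : ∀ j s x l {a b} → HasEdge a b (classBlock j s x l) → Covered a b
  by-class j s x l e = Any.++⁺ʳ coreBlocks (Any.++⁺ʳ columnBlocks (Any.++⁺ʳ boseBlocks
    (Any-gather j (Any-gather s (Any-gather x (Any.tabulate⁺ {f = classBlock j s x} l e))))))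

  -- A block with difference d joins ⟨ x , l ⟩ to ⟨ x ⊕ d , next l ⟩ and
  -- ⟨ x , next l ⟩ to ⟨ x ⊕ d , l ⟩; a block centred at x ⊕ e joins ⟨ x , l ⟩
  -- to ⟨ x ⊕ 2e , l ⟩, which is why k must be odd.
  same-level : ∀ x l {e} → Difference e → Covered ⟨ x , l ⟩ ⟨ x ⊕ e ⊕ e , l ⟩
  same-level x l (isClass j) =
    by-class j 2F (x ⊕ classDiff j) l (inj₂ (inj₁ (cong ⟨_, l ⟩ (sym ([y⊕x]⊖x≡y x (classDiff j))) , refl)))
  same-level x l (isBose i) =
    by-bose i (x ⊕ boseDiff i) l (inj₂ (inj₁ (cong ⟨_, l ⟩ (sym ([y⊕x]⊖x≡y x (boseDiff i))) , refl)))

  up-level : ∀ x l {d} → Difference d → Covered ⟨ x , l ⟩ ⟨ x ⊕ d , next l ⟩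
  up-level x l (isClass j) = by-class j 0F x l (inj₂ (inj₁ (refl , refl)))
  up-level x l (isBose i) =
    by-bose i (x ⊕ boseDiff i) l (inj₁ (cong ⟨_, l ⟩ (sym ([y⊕x]⊖x≡y x (boseDiff i))) , refl))

  down-level : ∀ x l {d} → Difference d → Covered ⟨ x , next l ⟩ ⟨ x ⊕ d , l ⟩
  down-level x l (isClass j) = by-class j 1F x l (inj₂ (inj₁ (refl , refl)))
  down-level x l (isBose i) = by-bose i x l (inj₂ (inj₂ (refl , refl)))

  covers-levels : ∀ {x y} i l → x ≢ y → Covered ⟨ x , i ⟩ ⟨ y , l ⟩
  covers-levels {x} {y} i l x≢y with level-trichotomy i l
  ... | inj₁ refl = subst (λ z → Covered ⟨ x , i ⟩ ⟨ z , i ⟩) (x⊕½[y⊖x]⊕½[y⊖x]≡y x y)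
                      (same-level x i (difference (d≢0 ∘ half≡0⇒≡0 (y ⊖ x))))
    where d≢0 = x≢y ∘ sym ∘ y⊖x≡0⇒y≡x
  ... | inj₂ (inj₁ refl) = subst (λ z → Covered ⟨ x , i ⟩ ⟨ z , next i ⟩) (x⊕[y⊖x]≡y x y)
                             (up-level x i (difference (x≢y ∘ sym ∘ y⊖x≡0⇒y≡x)))
  ... | inj₂ (inj₂ refl) = subst (λ z → Covered ⟨ x , next l ⟩ ⟨ z , l ⟩) (x⊕[y⊖x]≡y x y)
                             (down-level x l (difference (x≢y ∘ sym ∘ y⊖x≡0⇒y≡x)))

  from-class : ∀ j s y l → Covered (classPoint j s) ⟨ y , l ⟩
  from-class j 0F y l = by-class j 0F (y ⊖ classDiff j) (prev l)
    (inj₂ (inj₂ (refl , sym (cong₂ ⟨_,_⟩ ([y⊖x]⊕x≡y y (classDiff j)) (next-prev l)))))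
  from-class j 1F y l = by-class j 1F (y ⊖ classDiff j) l
    (inj₂ (inj₂ (refl , sym (cong ⟨_, l ⟩ ([y⊖x]⊕x≡y y (classDiff j))))))
  from-class j 2F y l = by-class j 2F (y ⊖ classDiff j) l
    (inj₂ (inj₂ (refl , sym (cong ⟨_, l ⟩ ([y⊖x]⊕x≡y y (classDiff j))))))

  to-class : ∀ j s y l → Covered ⟨ y , l ⟩ (classPoint j s)
  to-class j 0F y l = by-class j 0F y l (inj₁ (refl , refl))
  to-class j 1F y l = by-class j 1F y (prev l) (inj₁ (cong ⟨ y ,_⟩ (sym (next-prev l)) , refl))
  to-class j 2F y l = by-class j 2F (y ⊕ classDiff j) l
    (inj₁ (cong ⟨_, l ⟩ (sym ([y⊕x]⊖x≡y y (classDiff j))) , refl))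

  covering : Covering blocks
  covering (inj₁ c) (inj₁ c′) c≢c′ = Any.++⁺ˡ (Any.map⁺ (Any.map (λ {t} → hasEdge-map inj₁ t)
    (core-covering c c′ (c≢c′ ∘ cong inj₁))))
  covering (inj₁ c) (inj₂ (y , l)) _ with corePoint c
  ... | isFixed i refl =
    subst₂ Covered (columnPoint-fixed y i) (columnPoint-level y l) (by-column y (↑ˡ≢↑ʳ i l))
  ... | isClassPoint j s refl = from-class j s y l
  covering (inj₂ (y , l)) (inj₁ c) _ with corePoint c
  ... | isFixed i refl =
    subst₂ Covered (columnPoint-level y l) (columnPoint-fixed y i) (by-column y (↑ˡ≢↑ʳ i l ∘ sym))
  ... | isClassPoint j s refl = to-class j s y l
  covering (inj₂ (x , i)) (inj₂ (y , l)) p≢q with x ≟ y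
  ... | yes refl = subst₂ Covered (columnPoint-level x i) (columnPoint-level x l)
                     (by-column x (p≢q ∘ cong ⟨ x ,_⟩ ∘ Fin.↑ʳ-injective u i l))
  ... | no x≢y = covers-levels i l x≢y

  ⟨⟩-injective : ∀ {x y i l} → ⟨ x , i ⟩ ≡ ⟨ y , l ⟩ → x ≡ y × i ≡ l
  ⟨⟩-injective refl = refl , refl

  columnPoint-injective : ∀ x → Injective _≡_ _≡_ (columnPoint x)
  columnPoint-injective x {c} {c′} eq = begin
    c                            ≡⟨ Fin.join-splitAt u 3 c ⟨
    Fin.join u 3 (splitAt u c)   ≡⟨ cong (Fin.join u 3) (split-injective (splitAt u c) (splitAt u c′) eq) ⟩
    Fin.join u 3 (splitAt u c′)  ≡⟨ Fin.join-splitAt u 3 c′ ⟩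
    c′                           ∎
    where
      open ≡-Reasoning
      split-injective : ∀ p q → [ fixed , ⟨ x ,_⟩ ]′ p ≡ [ fixed , ⟨ x ,_⟩ ]′ q → p ≡ q
      split-injective (inj₁ i) (inj₁ i′) eq = cong inj₁ (Fin.↑ˡ-injective (r * 3) i i′ (inj₁-injective eq))
      split-injective (inj₂ l) (inj₂ l′) refl = refl

  bose-nondegenerate : ∀ i x l → Nondegenerate (bose i x l)
  bose-nondegenerate i x l =
    ≢-next l ∘ proj₂ ∘ ⟨⟩-injective ,
    (λ eq → boseDiff≢0 (x⊖e≡x⊕e⇒e≡0 x (boseDiff i) (proj₁ (⟨⟩-injective eq)))) ,
    ≢-next l ∘ sym ∘ proj₂ ∘ ⟨⟩-injective
    where
      boseDiff≢0 : boseDiff i ≢ Fin.zero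
      boseDiff≢0 ()

  classBlock-nondegenerate : ∀ j s x l → Nondegenerate (classBlock j s x l)
  classBlock-nondegenerate j 0F x l = (λ ()) , ≢-next l ∘ proj₂ ∘ ⟨⟩-injective , (λ ())
  classBlock-nondegenerate j 1F x l = (λ ()) , ≢-next l ∘ sym ∘ proj₂ ∘ ⟨⟩-injective , (λ ())
  classBlock-nondegenerate j 2F x l =
    (λ ()) , (λ eq → classDiff≢0 (x⊖e≡x⊕e⇒e≡0 x (classDiff j) (proj₁ (⟨⟩-injective eq)))) , (λ ())
    where
      classDiff≢0 : classDiff j ≢ Fin.zero
      classDiff≢0 ()

  nondegenerate : All Nondegenerate blocks
  nondegenerate =
    All.++⁺ (All.map⁺ (All.map (nondegenerate-map inj₁-injective) core-nondegenerate)) (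
    All.++⁺ (All-gather λ x → All.map⁺ (All.map (nondegenerate-map (columnPoint-injective x)) column-nondegenerate)) (
    All.++⁺ (All-gather λ i → All-gather λ x → All.tabulate⁺ (bose-nondegenerate i x))
            (All-gather λ j → All-gather λ s → All-gather λ x → All.tabulate⁺ (classBlock-nondegenerate j s x))))

  length-blocks : length blocks ≡ length core + (k * length column + (m * (k * 3) + r * (3 * (k * 3))))
  length-blocks = begin
    length blocks
      ≡⟨ List.length-++ coreBlocks ⟩
    length coreBlocks + length (columnBlocks ++ boseBlocks ++ classBlocks)
      ≡⟨ cong₂ _+_ (List.length-map _ core) (List.length-++ columnBlocks) ⟩
    length core + (length columnBlocks + length (boseBlocks ++ classBlocks))
      ≡⟨ cong (λ n → length core + (length columnBlocks + n)) (List.length-++ boseBlocks) ⟩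
    length core + (length columnBlocks + (length boseBlocks + length classBlocks))
      ≡⟨ cong (length core +_) (cong₂ _+_ columns (cong₂ _+_ boses classes)) ⟩
    length core + (k * length column + (m * (k * 3) + r * (3 * (k * 3)))) ∎
    where
      open ≡-Reasoning
      columns = length-gather k (λ x → List.length-map (mapTri (columnPoint x)) column)
      boses = length-gather m (λ i → length-gather k (λ x → List.length-tabulate (bose i x)))
      classes = length-gather r λ j → length-gather 3 λ s → length-gather k λ x →
                  List.length-tabulate (classBlock j s x)

  size : 3 * length blocks + V ≡ V * V
  size = begin
    3 * length blocks + V
      ≡⟨ cong (λ n → 3 * n + V) length-blocks ⟩
    3 * (length core + (k * length column + (m * (k * 3) + r * (3 * (k * 3))))) + V
      ≡⟨ regroup (length core) (length column) w k m r ⟩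
    (3 * length core + w) + k * (3 * length column) + (m * (k * 9) + r * (k * 27) + k * 3)
      ≡⟨ cong₂ (λ a b → a + k * b + (m * (k * 9) + r * (k * 27) + k * 3)) core-size column-size ⟩
    w * w + k * (6 * suc u) + (m * (k * 9) + r * (k * 27) + k * 3)
      ≡⟨ expand u r m ⟩
    V * V ∎
    where
      open ≡-Reasoning
      regroup : ∀ L₀ L₁ w k m r →
        3 * (L₀ + (k * L₁ + (m * (k * 3) + r * (3 * (k * 3))))) + (w + k * 3) ≡
        (3 * L₀ + w) + k * (3 * L₁) + (m * (k * 9) + r * (k * 27) + k * 3)
      regroup = solve-∀
      expand : ∀ u r m →
        (u + r * 3) * (u + r * 3) + suc (r + m) * (6 * suc u) +
        (m * (suc (r + m) * 9) + r * (suc (r + m) * 27) + suc (r + m) * 3) ≡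
        (u + r * 3 + suc (r + m) * 3) * (u + r * 3 + suc (r + m) * 3)
      expand = solve-∀

  points : Point ↔ Fin V
  points = ↔-sym ((↔-refl ⊎-↔ Fin.*↔×) ↔-∘ Fin.+↔⊎)

  blocksᵛ : List (Triple V)
  blocksᵛ = map (mapTri (Inverse.to points)) blocks

  isDTS : IsDTS V blocksᵛ
  isDTS = isDTS-byCounting
    (All.map⁺ (All.map (nondegenerate-map (Injection.injective (↔⇒↣ points))) nondegenerate))
    (covering-↔ points covering)
    (trans (cong (λ n → 3 * n + V) (List.length-map _ blocks)) size)

  unsequenceable : Unsequenceable core → Unsequenceable blocksᵛ
  unsequenceable = unsequenceable-map (Injection.injective (↔⇒↣ points))
                 ∘ unsequenceable-⊆ (xs⊆xs++ys coreBlocks _)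
                 ∘ unsequenceable-map inj₁-injective

decided : ∀ {A : Set} (a? : Dec A) {_ : True a?} → A
decided _ {a} = toWitness a

isDTS-byDecision : ∀ {v} (B : List (Triple v)) →
                   {_ : True (All.all? nondegenerate? B)} {_ : True (covering? B)} →
                   3 * length B + v ≡ v * v → IsDTS v B
isDTS-byDecision B {nondegenerate} {covering} = isDTS-byCounting (toWitness nondegenerate) (toWitness covering)

DTSWithoutGoodSequencing : ℕ → Set
DTSWithoutGoodSequencing v = ∃[ B ] (IsDTS v B × (∀ (σ : Permutation v v) → ¬ IsGoodSequencing B σ))

withoutGoodSequencing : ∀ {v} {B : List (Triple v)} → IsDTS v B → Unsequenceable B → DTSWithoutGoodSequencing v
withoutGoodSequencing dts unsequenceable = _ , dts , unsequenceable⇒¬goodSequencing unsequenceable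

core7 : List (Tri (Fin 7))
core7 =
  (# 0 , # 1 , # 2) ∷ (# 1 , # 0 , # 3) ∷ (# 2 , # 0 , # 4) ∷ (# 0 , # 5 , # 6) ∷ (# 1 , # 4 , # 5) ∷ (# 4 , # 1 , # 6) ∷
  (# 5 , # 2 , # 1) ∷ (# 2 , # 6 , # 3) ∷ (# 6 , # 2 , # 5) ∷ (# 5 , # 3 , # 0) ∷ (# 3 , # 6 , # 1) ∷ (# 4 , # 3 , # 2) ∷
  (# 3 , # 5 , # 4) ∷ (# 6 , # 4 , # 0) ∷ []

core9 : List (Tri (Fin 9))
core9 =
  (# 0 , # 8 , # 4) ∷ (# 1 , # 8 , # 5) ∷ (# 2 , # 8 , # 6) ∷ (# 3 , # 8 , # 7) ∷ (# 4 , # 8 , # 0) ∷ (# 5 , # 8 , # 1) ∷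
  (# 6 , # 8 , # 2) ∷ (# 7 , # 8 , # 3) ∷ (# 0 , # 2 , # 3) ∷ (# 1 , # 3 , # 4) ∷ (# 2 , # 4 , # 5) ∷ (# 3 , # 5 , # 6) ∷
  (# 4 , # 6 , # 7) ∷ (# 5 , # 7 , # 0) ∷ (# 6 , # 0 , # 1) ∷ (# 7 , # 1 , # 2) ∷ (# 0 , # 6 , # 5) ∷ (# 1 , # 7 , # 6) ∷
  (# 2 , # 0 , # 7) ∷ (# 3 , # 1 , # 0) ∷ (# 4 , # 2 , # 1) ∷ (# 5 , # 3 , # 2) ∷ (# 6 , # 4 , # 3) ∷ (# 7 , # 5 , # 4) ∷ []

column4 : List (Tri (Fin 4))
column4 = (# 0 , # 1 , # 2) ∷ (# 1 , # 0 , # 3) ∷ (# 2 , # 3 , # 0) ∷ (# 3 , # 2 , # 1) ∷ []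

column3 : List (Tri (Fin 3))
column3 = (# 0 , # 1 , # 2) ∷ (# 2 , # 1 , # 0) ∷ []

B10 : List (Triple 10)
B10 =
  (# 2 , # 6 , # 3) ∷ (# 0 , # 7 , # 4) ∷ (# 1 , # 8 , # 5) ∷ (# 3 , # 1 , # 2) ∷ (# 4 , # 2 , # 0) ∷ (# 5 , # 0 , # 1) ∷
  (# 8 , # 2 , # 9) ∷ (# 6 , # 0 , # 9) ∷ (# 7 , # 1 , # 9) ∷ (# 6 , # 5 , # 4) ∷ (# 7 , # 3 , # 5) ∷ (# 8 , # 4 , # 3) ∷
  (# 4 , # 5 , # 7) ∷ (# 3 , # 4 , # 6) ∷ (# 5 , # 3 , # 8) ∷ (# 9 , # 4 , # 8) ∷ (# 9 , # 5 , # 6) ∷ (# 9 , # 3 , # 7) ∷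
  (# 2 , # 8 , # 7) ∷ (# 1 , # 7 , # 6) ∷ (# 0 , # 6 , # 8) ∷ (# 5 , # 9 , # 2) ∷ (# 4 , # 9 , # 1) ∷ (# 3 , # 9 , # 0) ∷
  (# 1 , # 0 , # 3) ∷ (# 2 , # 1 , # 4) ∷ (# 0 , # 2 , # 5) ∷ (# 8 , # 6 , # 1) ∷ (# 7 , # 8 , # 0) ∷ (# 6 , # 7 , # 2) ∷ []

B12 : List (Triple 12)
B12 =
  (# 3 , # 11 , # 7) ∷ (# 2 , # 10 , # 6) ∷ (# 1 , # 9 , # 5) ∷ (# 0 , # 8 , # 4) ∷ (# 6 , # 3 , # 5) ∷ (# 4 , # 1 , # 7) ∷
  (# 7 , # 0 , # 6) ∷ (# 5 , # 2 , # 4) ∷ (# 4 , # 9 , # 10) ∷ (# 7 , # 8 , # 9) ∷ (# 5 , # 10 , # 11) ∷ (# 6 , # 11 , # 8) ∷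
  (# 5 , # 1 , # 6) ∷ (# 7 , # 3 , # 4) ∷ (# 4 , # 0 , # 5) ∷ (# 6 , # 2 , # 7) ∷ (# 11 , # 5 , # 0) ∷ (# 8 , # 6 , # 1) ∷
  (# 10 , # 4 , # 3) ∷ (# 9 , # 7 , # 2) ∷ (# 8 , # 0 , # 2) ∷ (# 11 , # 3 , # 1) ∷ (# 9 , # 1 , # 3) ∷ (# 10 , # 2 , # 0) ∷
  (# 0 , # 7 , # 1) ∷ (# 2 , # 5 , # 3) ∷ (# 3 , # 6 , # 0) ∷ (# 1 , # 4 , # 2) ∷ (# 6 , # 10 , # 9) ∷ (# 5 , # 9 , # 8) ∷
  (# 4 , # 8 , # 11) ∷ (# 7 , # 11 , # 10) ∷ (# 11 , # 6 , # 4) ∷ (# 8 , # 7 , # 5) ∷ (# 10 , # 5 , # 7) ∷ (# 9 , # 4 , # 6) ∷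
  (# 10 , # 1 , # 8) ∷ (# 11 , # 2 , # 9) ∷ (# 9 , # 0 , # 11) ∷ (# 8 , # 3 , # 10) ∷ (# 2 , # 1 , # 11) ∷ (# 3 , # 2 , # 8) ∷
  (# 1 , # 0 , # 10) ∷ (# 0 , # 3 , # 9) ∷ []

B18 : List (Triple 18)
B18 = map (mapTri (_↑ˡ 11)) core7 ++
  (# 7 , # 0 , # 11) ∷ (# 8 , # 0 , # 12) ∷ (# 9 , # 0 , # 13) ∷ (# 10 , # 0 , # 14) ∷ (# 11 , # 0 , # 15) ∷ (# 12 , # 0 , # 16) ∷
  (# 13 , # 0 , # 17) ∷ (# 14 , # 0 , # 7) ∷ (# 15 , # 0 , # 8) ∷ (# 16 , # 0 , # 9) ∷ (# 17 , # 0 , # 10) ∷ (# 7 , # 1 , # 12) ∷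
  (# 8 , # 1 , # 13) ∷ (# 9 , # 1 , # 14) ∷ (# 10 , # 1 , # 15) ∷ (# 11 , # 1 , # 16) ∷ (# 12 , # 1 , # 17) ∷ (# 13 , # 1 , # 7) ∷
  (# 14 , # 1 , # 8) ∷ (# 15 , # 1 , # 9) ∷ (# 16 , # 1 , # 10) ∷ (# 17 , # 1 , # 11) ∷ (# 7 , # 2 , # 13) ∷ (# 8 , # 2 , # 14) ∷
  (# 9 , # 2 , # 15) ∷ (# 10 , # 2 , # 16) ∷ (# 11 , # 2 , # 17) ∷ (# 12 , # 2 , # 7) ∷ (# 13 , # 2 , # 8) ∷ (# 14 , # 2 , # 9) ∷
  (# 15 , # 2 , # 10) ∷ (# 16 , # 2 , # 11) ∷ (# 17 , # 2 , # 12) ∷ (# 7 , # 3 , # 14) ∷ (# 8 , # 3 , # 15) ∷ (# 9 , # 3 , # 16) ∷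
  (# 10 , # 3 , # 17) ∷ (# 11 , # 3 , # 7) ∷ (# 12 , # 3 , # 8) ∷ (# 13 , # 3 , # 9) ∷ (# 14 , # 3 , # 10) ∷ (# 15 , # 3 , # 11) ∷
  (# 16 , # 3 , # 12) ∷ (# 17 , # 3 , # 13) ∷ (# 7 , # 4 , # 15) ∷ (# 8 , # 4 , # 16) ∷ (# 9 , # 4 , # 17) ∷ (# 10 , # 4 , # 7) ∷
  (# 11 , # 4 , # 8) ∷ (# 12 , # 4 , # 9) ∷ (# 13 , # 4 , # 10) ∷ (# 14 , # 4 , # 11) ∷ (# 15 , # 4 , # 12) ∷ (# 16 , # 4 , # 13) ∷
  (# 17 , # 4 , # 14) ∷ (# 7 , # 5 , # 16) ∷ (# 8 , # 5 , # 17) ∷ (# 9 , # 5 , # 7) ∷ (# 10 , # 5 , # 8) ∷ (# 11 , # 5 , # 9) ∷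
  (# 12 , # 5 , # 10) ∷ (# 13 , # 5 , # 11) ∷ (# 14 , # 5 , # 12) ∷ (# 15 , # 5 , # 13) ∷ (# 16 , # 5 , # 14) ∷ (# 17 , # 5 , # 15) ∷
  (# 7 , # 6 , # 17) ∷ (# 8 , # 6 , # 7) ∷ (# 9 , # 6 , # 8) ∷ (# 10 , # 6 , # 9) ∷ (# 11 , # 6 , # 10) ∷ (# 12 , # 6 , # 11) ∷
  (# 13 , # 6 , # 12) ∷ (# 14 , # 6 , # 13) ∷ (# 15 , # 6 , # 14) ∷ (# 16 , # 6 , # 15) ∷ (# 17 , # 6 , # 16) ∷ (# 7 , # 8 , # 10) ∷
  (# 8 , # 9 , # 11) ∷ (# 9 , # 10 , # 12) ∷ (# 10 , # 11 , # 13) ∷ (# 11 , # 12 , # 14) ∷ (# 12 , # 13 , # 15) ∷ (# 13 , # 14 , # 16) ∷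
  (# 14 , # 15 , # 17) ∷ (# 15 , # 16 , # 7) ∷ (# 16 , # 17 , # 8) ∷ (# 17 , # 7 , # 9) ∷ []

core7-unsequenceable : Unsequenceable core7
core7-unsequenceable = refutes⇒unsequenceable core7 _

core9-unsequenceable : Unsequenceable core9
core9-unsequenceable = refutes⇒unsequenceable core9 _

noGoodSequencing-10 : DTSWithoutGoodSequencing 10
noGoodSequencing-10 = withoutGoodSequencing (isDTS-byDecision B10 refl) (refutes⇒unsequenceable B10 _)

noGoodSequencing-12 : DTSWithoutGoodSequencing 12
noGoodSequencing-12 = withoutGoodSequencing (isDTS-byDecision B12 refl) (refutes⇒unsequenceable B12 _)

noGoodSequencing-18 : DTSWithoutGoodSequencing 18
noGoodSequencing-18 = withoutGoodSequencing (isDTS-byDecision B18 refl)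
  (unsequenceable-⊆ (xs⊆xs++ys _ _) (unsequenceable-map (Fin.↑ˡ-injective 11 _ _) core7-unsequenceable))

noGoodSequencing-16+6t : ∀ t → DTSWithoutGoodSequencing (4 + (2 + t) * 6)
noGoodSequencing-16+6t t = subst DTSWithoutGoodSequencing (order t)
  (withoutGoodSequencing isDTS (unsequenceable core7-unsequenceable))
  where
    open Extension 1 2 (t + t) (suc t) (cong suc (sym (ℕ.+-suc t t)))
      core7 (decided (All.all? nondegenerate? core7)) (decided (covering? core7)) refl
      column4 (decided (All.all? nondegenerate? column4)) (decided (covering? column4)) refl
    order : ∀ t → 1 + 2 * 3 + suc (2 + (t + t)) * 3 ≡ 4 + (2 + t) * 6
    order = solve-∀

noGoodSequencing-24+6t : ∀ t → DTSWithoutGoodSequencing ((4 + t) * 6)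
noGoodSequencing-24+6t t = subst DTSWithoutGoodSequencing (order t)
  (withoutGoodSequencing isDTS (unsequenceable core9-unsequenceable))
  where
    odd : ∀ t → 3 + suc (t + t) ≡ (2 + t) + (2 + t)
    odd = solve-∀
    open Extension 0 3 (suc (t + t)) (2 + t) (odd t)
      core9 (decided (All.all? nondegenerate? core9)) (decided (covering? core9)) refl
      column3 (decided (All.all? nondegenerate? column3)) (decided (covering? column3)) refl
    order : ∀ t → 0 + 3 * 3 + suc (3 + suc (t + t)) * 3 ≡ (4 + t) * 6
    order = solve-∀

noGoodSequencing-0mod6 : ∀ q → 10 ≤ q * 6 → DTSWithoutGoodSequencing (q * 6)
noGoodSequencing-0mod6 0 ()
noGoodSequencing-0mod6 1 10≤6 = contradiction 10≤6 (from-no (10 ℕ.≤? 6))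
noGoodSequencing-0mod6 2 _ = noGoodSequencing-12
noGoodSequencing-0mod6 3 _ = noGoodSequencing-18
noGoodSequencing-0mod6 (suc (suc (suc (suc t)))) _ = noGoodSequencing-24+6t t

noGoodSequencing-4mod6 : ∀ q → 10 ≤ 4 + q * 6 → DTSWithoutGoodSequencing (4 + q * 6)
noGoodSequencing-4mod6 0 10≤4 = contradiction 10≤4 (from-no (10 ℕ.≤? 4))
noGoodSequencing-4mod6 1 _ = noGoodSequencing-10
noGoodSequencing-4mod6 (suc (suc t)) _ = noGoodSequencing-16+6t t

by-residue-mod-6 : ∀ {v r} → v % 6 ≡ r →
                   (∀ q → 10 ≤ r + q * 6 → DTSWithoutGoodSequencing (r + q * 6)) →
                   v ≥ 10 → DTSWithoutGoodSequencing v
by-residue-mod-6 {v} v%6≡r family v≥10 =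
  subst DTSWithoutGoodSequencing (sym v≡r+q*6) (family (v / 6) (subst (10 ≤_) v≡r+q*6 v≥10))
  where v≡r+q*6 = trans (m≡m%n+[m/n]*n v 6) (cong (_+ v / 6 * 6) v%6≡r)

corollary5p5 : (v : ℕ) → (v % 6 ≡ 0 ⊎ v % 6 ≡ 4) → v ≥ 10 →
    ∃[ B ] (IsDTS v B × (∀ (σ : Permutation v v) → ¬ IsGoodSequencing B σ))
corollary5p5 v (inj₁ v%6≡0) = by-residue-mod-6 v%6≡0 noGoodSequencing-0mod6
corollary5p5 v (inj₂ v%6≡4) = by-residue-mod-6 v%6≡4 noGoodSequencing-4mod6
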